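{- Suppose that $a$ and $b$ are integers with $0\le a<b$, and that $h$ is a natural number with $2b-a\le h\le 2b-a+\Delta(b-a)$. Then one has $$B_{a,b}^{1,3}(p)\le 6\quad\text{and}\quad B_{a,b}^{2,h/b}(p)\le 6p^{h-2b+a}.$$
   Context: $\Delta$ is a fixed real number with $0<\Delta<1/12$. $p$ is a fixed prime number (in the paper's standing setting $p$ is a prime with $M<p\le 2M$ for a large real number $M$; in particular $p>3$). For an integer $c\ge 0$, an integer $\xi$ and $n\in\{1,2\}$, let $\Xi_c^n(\xi)$ be the set of integral $n$-tuples $(\xi_1,\dots,\xi_n)$ with $1\le \xi_i\le p^{c+1}$ and $\xi_i\equiv \xi\pmod{p^c}$ for all $i$, and, when $n=2$, with $\xi_1\not\equiv\xi_2\pmod{p^{c+1}}$. For integers $1\le a<b$, integers $\xi,\eta$ and an integral triple $\mathbf m=(m_1,m_2,m_3)$, let $\mathcal B_{a,b}^n(\mathbf m;\xi,\eta)$ be the set of integral $n$-tuples $\mathbf z$ with $1\le z_i\le p^{3b}$ satisfying $\sum_{i=1}^n (z_i-\eta)^j\equiv m_j\pmod{p^{jb}}$ $(1\le j\le 3)$ and $\mathbf z\equiv\boldsymbol\xi\pmod{p^{a+1}}$ (componentwise) for some $\boldsymbol\xi\in\Xi_a^n(\xi)$. When $a=0$, $\mathcal B_{0,b}^n(\mathbf m;\xi,\eta)$ is the set of such $\mathbf z$ (same congruences, same range) with $\mathbf z\equiv\boldsymbol\xi\pmod p$ for some $\boldsymbol\xi\in\Xi_0^n(\xi)$ and in addition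 $z_i\not\equiv\eta\pmod p$ for all $i$. Two $n$-tuples $\mathbf x,\mathbf y$ are called $\mathcal R(\mu)$-equivalent when $\mathbf x\equiv\mathbf y\pmod{p^\mu}$ componentwise. For a real $h$ with $hb\in\mathbb Z$, $\mathcal C_{a,b}^{n,h}(\mathbf m;\xi,\eta)$ denotes the set of $\mathcal R(hb)$-equivalence classes of $\mathcal B_{a,b}^n(\mathbf m;\xi,\eta)$. For $a\ge1$, $B_{a,b}^{n,h}(p)$ is the maximum of $\mathrm{card}(\mathcal C_{a,b}^{n,h}(\mathbf m;\xi,\eta))$ over $1\le\xi\le p^a$, $1\le\eta\le p^b$ with $\eta\not\equiv\xi\pmod p$, and $1\le m_j\le p^{3b}$; for $a=0$, $B_{0,b}^{n,h}(p)$ is the maximum of $\mathrm{card}(\mathcal C_{0,b}^{n,h}(\mathbf m;0,\eta))$ over $1\le\eta\le p^b$ and $1\le m_j\le p^{3b}$. -}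

module Defs where

open import Data.Nat as ℕ using (ℕ; zero; suc)
open import Data.Integer as ℤ using (ℤ; +_)
open import Data.Fin using (Fin; zero; suc)
open import Data.Product using (Σ; ∃; _×_; _,_)
open import Relation.Nullary using (¬_)
open import Relation.Binary.PropositionalEquality using (_≡_; _≢_)

Cong : ℤ → ℤ → ℕ → Set
Cong x y m = ∃ λ (k : ℤ) → x ℤ.- y ≡ k ℤ.* (+ m)

Tuple : ℕ → Set
Tuple n = Fin n → ℤ

powSum : (n : ℕ) → Tuple n → ℤ → ℕ → ℤ
powSum zero    z η j = + 0
powSum (suc n) z η j = (z zero ℤ.- η) ℤ.^ j ℤ.+ powSum n (λ i → z (suc i)) η j

-- componentwise congruence: the R(μ)-equivalence when m = p^μ
TupCong : {n : ℕ} → Tuple n → Tuple n → ℕ → Set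
TupCong {n} x y m = (i : Fin n) → Cong (x i) (y i) m

InXi : (p c n : ℕ) → ℤ → Tuple n → Set
InXi p c n ξ xs =
  ((i : Fin n) → (+ 1 ℤ.≤ xs i) × (xs i ℤ.≤ + (p ℕ.^ suc c)) × Cong (xs i) ξ (p ℕ.^ c))
  × ((i j : Fin n) → i ≢ j → ¬ Cong (xs i) (xs j) (p ℕ.^ suc c))

InB : (p a b n : ℕ) → (m₁ m₂ m₃ ξ η : ℤ) → Tuple n → Set
InB p a b n m₁ m₂ m₃ ξ η z =
  ((i : Fin n) → (+ 1 ℤ.≤ z i) × (z i ℤ.≤ + (p ℕ.^ (3 ℕ.* b))))
  × Cong (powSum n z η 1) m₁ (p ℕ.^ (1 ℕ.* b))
  × Cong (powSum n z η 2) m₂ (p ℕ.^ (2 ℕ.* b))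
  × Cong (powSum n z η 3) m₃ (p ℕ.^ (3 ℕ.* b))
  × (∃ λ (xs : Tuple n) → InXi p a n ξ xs × TupCong z xs (p ℕ.^ suc a))
  × (a ≡ 0 → (i : Fin n) → ¬ Cong (z i) η p)

-- the parameter ranges over which B_{a,b}^{n,h}(p) is the maximum
Admissible : (p a b : ℕ) → (m₁ m₂ m₃ ξ η : ℤ) → Set
Admissible p a b m₁ m₂ m₃ ξ η =
  ((+ 1 ℤ.≤ η) × (η ℤ.≤ + (p ℕ.^ b)))
  × (+ 1 ℤ.≤ m₁) × (m₁ ℤ.≤ + (p ℕ.^ (3 ℕ.* b)))
  × (+ 1 ℤ.≤ m₂) × (m₂ ℤ.≤ + (p ℕ.^ (3 ℕ.* b)))
  × (+ 1 ℤ.≤ m₃) × (m₃ ℤ.≤ + (p ℕ.^ (3 ℕ.* b)))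
  × ((a ≡ 0 → ξ ≡ + 0)
     × (¬ a ≡ 0 → (+ 1 ℤ.≤ ξ) × (ξ ℤ.≤ + (p ℕ.^ a)) × ¬ Cong η ξ p))

-- card(𝓒_{a,b}^{n,h}(m;ξ,η)) ≤ N, where μ = hb is the exponent of the
-- R(μ)-equivalence: any family of elements of 𝓑 that are pairwise
-- R(μ)-inequivalent (i.e. represent distinct classes) has at most N members.
ClassCardLe : (p a b n μ : ℕ) → (m₁ m₂ m₃ ξ η : ℤ) → ℕ → Set
ClassCardLe p a b n μ m₁ m₂ m₃ ξ η N =
  (k : ℕ) (f : Fin k → Tuple n) →
  ((i : Fin k) → InB p a b n m₁ m₂ m₃ ξ η (f i)) →
  ((i j : Fin k) → i ≢ j → ¬ TupCong (f i) (f j) (p ℕ.^ μ)) →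
  k ℕ.≤ N

-- B_{a,b}^{n,h}(p) ≤ N, with μ = hb
BLe : (p a b n μ N : ℕ) → Set
BLe p a b n μ N =
  (m₁ m₂ m₃ ξ η : ℤ) → Admissible p a b m₁ m₂ m₃ ξ η →
  ClassCardLe p a b n μ m₁ m₂ m₃ ξ η N

{-# OPTIONS --safe #-}
module Submission where

-- Write X = z₁ − η and Y = z₂ − η; both are units modulo p. For n = 1, X ≡ X′ (mod p) and
-- X³ ≡ X′³ (mod p^{3b}) give X ≡ X′ (mod p^{3b}) because X² + XX′ + X′² ≡ 3X² is a unit (p > 3),
-- so there is a single class. For n = 2, Newton's identities turn the congruences on the first
-- three power sums into X + Y ≡ X′ + Y′ and (X − Y)² ≡ (X′ − Y′)² modulo p^{2b}; as p^a divides
-- X − Y exactly, this determines {X, Y} modulo p^{2b−a} up to order. Hence the first coordinates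
-- lie in two classes modulo p^{2b−a}, each containing at most p^{h−2b+a} residues modulo p^h, and
-- since h ≤ 3b the first coordinate modulo p^h determines the second, again through the cubes.

open import Defs
open import Data.Nat using (ℕ; _+_; _*_; _∸_; _^_; _≤_; _<_)
open import Data.Nat.Primality using (Prime)
open import Data.Product using (_×_)

open import Data.Nat using (zero; suc; NonZero; >-nonZero; z≤n; s≤s)
import Data.Nat.Properties as ℕ
open import Data.Nat.Divisibility using (_∣_; divides; 1∣_; ∣-trans; m∣m*n; ∣⇒≤; *-cancelʳ-∣; *-monoˡ-∣)
open import Data.Nat.Primality using (euclidsLemma; prime⇒nonZero)
open import Data.Integer as ℤ using (ℤ; +_)
import Data.Integer.Properties as ℤᵖ
import Data.Integer.DivMod as ℤ
open import Data.Integer.Divisibility.Signed as ℤᵈ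
  using (divides; ∣ᵤ⇒∣; ∣⇒∣ᵤ; ∣m∣n⇒∣m+n; ∣m∣n⇒∣m-n; ∣n⇒∣m*n; ∣m⇒∣m*n; ∣m⇒∣-m; _∣?_)
open import Data.Integer.Tactic.RingSolver using (solve; solve-∀)
open import Data.Fin using (Fin; zero; suc; fromℕ<; combine; remQuot)
open import Data.Fin.Properties using (fromℕ<-injective; remQuot-combine; injective⇒≤; _≟_)
open import Data.List using (_∷_; [])
open import Data.Product using (∃-syntax; _,_; proj₁; proj₂)
import Data.Product as Product
open import Data.Product.Properties using (,-injective)
open import Data.Sum using (_⊎_; inj₁; inj₂; [_,_]′)
import Data.Sum as Sum
open import Data.Empty using (⊥-elim)
open import Function using (_∘_)
open import Relation.Nullary using (¬_; yes; no)
open import Relation.Nullary.Decidable using (decidable-stable)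
open import Relation.Binary.PropositionalEquality
  using (_≡_; refl; sym; trans; cong; cong₂; subst; subst₂; module ≡-Reasoning)

private variable
  p m n k a b h : ℕ
  x y w x′ y′ m₁ m₂ m₃ ξ η : ℤ
  z z′ : Tuple n

infix 4 _∣ℤ_ _≡_mod_

_∣ℤ_ : ℕ → ℤ → Set
m ∣ℤ x = + m ℤᵈ.∣ x

-- A record rather than a definition, so that x and y can be inferred from a congruence.
record _≡_mod_ (x y : ℤ) (m : ℕ) : Set where
  constructor congruent
  field difference : m ∣ℤ x ℤ.- y

∣ℤ-≡ : m ∣ℤ x → x ≡ y → m ∣ℤ y
∣ℤ-≡ m∣x refl = m∣x

Cong⇒≡mod : Cong x y m → x ≡ y mod m
Cong⇒≡mod (k , eq) = congruent (divides k eq)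

≡mod⇒Cong : x ≡ y mod m → Cong x y m
≡mod⇒Cong (congruent (divides k eq)) = k , eq

≡mod-sym : x ≡ y mod m → y ≡ x mod m
≡mod-sym {x = x} {y = y} (congruent m∣x-y) = congruent (∣ℤ-≡ (∣m⇒∣-m m∣x-y) negate)
  where
  negate : ℤ.- (x ℤ.- y) ≡ y ℤ.- x
  negate = solve (x ∷ y ∷ [])

≡mod-trans : x ≡ y mod m → y ≡ w mod m → x ≡ w mod m
≡mod-trans {x = x} {y = y} {w = w} (congruent m∣x-y) (congruent m∣y-w) =
  congruent (∣ℤ-≡ (∣m∣n⇒∣m+n m∣x-y m∣y-w) telescope)
  where
  telescope : (x ℤ.- y) ℤ.+ (y ℤ.- w) ≡ x ℤ.- w
  telescope = solve (x ∷ y ∷ w ∷ [])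

Cong-common⇒≡mod : ∀ w → Cong x w m → Cong y w m → x ≡ y mod m
Cong-common⇒≡mod w x≡w y≡w = ≡mod-trans (Cong⇒≡mod x≡w) (≡mod-sym (Cong⇒≡mod y≡w))

sub-sub-cancelʳ : ∀ x y w → (x ℤ.- w) ℤ.- (y ℤ.- w) ≡ x ℤ.- y
sub-sub-cancelʳ = solve-∀

≡mod-shift : x ≡ y mod m → x ℤ.- w ≡ y ℤ.- w mod m
≡mod-shift {x = x} {y = y} {w = w} (congruent m∣x-y) = congruent (∣ℤ-≡ m∣x-y (sym (sub-sub-cancelʳ x y w)))

≡mod-unshift : x ℤ.- w ≡ y ℤ.- w mod m → x ≡ y mod m
≡mod-unshift {x = x} {w = w} {y = y} (congruent m∣x-y) = congruent (∣ℤ-≡ m∣x-y (sub-sub-cancelʳ x y w))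

∣ℤ-weaken : m ∣ n → n ∣ℤ x → m ∣ℤ x
∣ℤ-weaken m∣n = ℤᵈ.∣-trans (∣ᵤ⇒∣ m∣n)

≡mod-resp : x ≡ y mod m → x ≡ x′ → y ≡ y′ → x′ ≡ y′ mod m
≡mod-resp x≡y refl refl = x≡y

≡mod-weaken : m ∣ n → x ≡ y mod n → x ≡ y mod m
≡mod-weaken m∣n (congruent n∣x-y) = congruent (∣ℤ-weaken m∣n n∣x-y)

≡mod-cube : x ≡ y mod m → x ℤ.* x ℤ.* x ≡ y ℤ.* y ℤ.* y mod m
≡mod-cube {x = x} {y = y} (congruent m∣x-y) =
  congruent (∣ℤ-≡ (∣m⇒∣m*n (x ℤ.* x ℤ.+ x ℤ.* y ℤ.+ y ℤ.* y) m∣x-y) factor)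
  where
  factor : (x ℤ.- y) ℤ.* (x ℤ.* x ℤ.+ x ℤ.* y ℤ.+ y ℤ.* y) ≡ x ℤ.* x ℤ.* x ℤ.- y ℤ.* y ℤ.* y
  factor = solve (x ∷ y ∷ [])

≡mod-+-cancelˡ : x ℤ.+ y ≡ x′ ℤ.+ y′ mod m → x ≡ x′ mod m → y ≡ y′ mod m
≡mod-+-cancelˡ {x = x} {y = y} {x′ = x′} {y′ = y′} (congruent m∣σ) (congruent m∣x-x′) =
  congruent (∣ℤ-≡ (∣m∣n⇒∣m-n m∣σ m∣x-x′) cancel)
  where
  cancel : (x ℤ.+ y) ℤ.- (x′ ℤ.+ y′) ℤ.- (x ℤ.- x′) ≡ y ℤ.- y′
  cancel = solve (x ∷ y ∷ x′ ∷ y′ ∷ [])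

^-monoʳ-∣ : ∀ p → m ≤ n → p ^ m ∣ p ^ n
^-monoʳ-∣ {m = m} {n = n} p m≤n = divides (p ^ (n ∸ m)) (begin
  p ^ n               ≡⟨ cong (p ^_) (sym (ℕ.m∸n+n≡m m≤n)) ⟩
  p ^ (n ∸ m + m)     ≡⟨ ℕ.^-distribˡ-+-* p (n ∸ m) m ⟩
  p ^ (n ∸ m) * p ^ m ∎)
  where open ≡-Reasoning

^-+-∸ : ∀ p → m ≤ n → p ^ m * p ^ (n ∸ m) ≡ p ^ n
^-+-∸ {m = m} {n = n} p m≤n = trans (sym (ℕ.^-distribˡ-+-* p m (n ∸ m))) (cong (p ^_) (ℕ.m+[n∸m]≡n m≤n))

^-∣ℤ-weaken : ∀ p → m ≤ n → p ^ n ∣ℤ x → p ^ m ∣ℤ x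
^-∣ℤ-weaken p m≤n = ∣ℤ-weaken (^-monoʳ-∣ p m≤n)

^-≡mod-weaken : ∀ p → m ≤ n → x ≡ y mod p ^ n → x ≡ y mod p ^ m
^-≡mod-weaken p m≤n = ≡mod-weaken (^-monoʳ-∣ p m≤n)

^-∣ℤ⇒∣ℤ : ∀ p n → 1 ≤ n → p ^ n ∣ℤ x → p ∣ℤ x
^-∣ℤ⇒∣ℤ p (suc n) _ = ∣ℤ-weaken (m∣m*n (p ^ n))

^-≡mod⇒≡mod : ∀ p n → 1 ≤ n → x ≡ y mod p ^ n → x ≡ y mod p
^-≡mod⇒≡mod p n 1≤n (congruent p^n∣x-y) = congruent (^-∣ℤ⇒∣ℤ p n 1≤n p^n∣x-y)

prime-∣ℤ-* : Prime p → p ∣ℤ x ℤ.* y → p ∣ℤ x ⊎ p ∣ℤ y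
prime-∣ℤ-* {x = x} {y = y} pp p∣xy =
  Sum.map ∣ᵤ⇒∣ ∣ᵤ⇒∣ (euclidsLemma ℤ.∣ x ∣ ℤ.∣ y ∣ pp (subst (_ ∣_) (ℤᵖ.abs-* x y) (∣⇒∣ᵤ p∣xy)))

prime-∤ℤ-* : Prime p → ¬ p ∣ℤ x → ¬ p ∣ℤ y → ¬ p ∣ℤ x ℤ.* y
prime-∤ℤ-* pp p∤x p∤y p∣xy = [ p∤x , p∤y ]′ (prime-∣ℤ-* pp p∣xy)

prime^-∣-*-cancelˡ : Prime p → ¬ p ∣ m → ∀ n → p ^ n ∣ m * k → p ^ n ∣ k
prime^-∣-*-cancelˡ pp p∤m zero _ = 1∣ _
prime^-∣-*-cancelˡ {p = p} {m = m} {k = k} pp p∤m (suc n) p^1+n∣mk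
  with euclidsLemma m k pp (∣-trans (m∣m*n (p ^ n)) p^1+n∣mk)
... | inj₁ p∣m = ⊥-elim (p∤m p∣m)
... | inj₂ (divides q refl) = subst (_∣ q * p) (ℕ.*-comm (p ^ n) p) (*-monoˡ-∣ p p^n∣q)
  where
  instance _ = prime⇒nonZero pp
  p^n∣q : p ^ n ∣ q
  p^n∣q = prime^-∣-*-cancelˡ pp p∤m n (*-cancelʳ-∣ p
    (subst₂ _∣_ (ℕ.*-comm p (p ^ n)) (sym (ℕ.*-assoc m q p)) p^1+n∣mk))

prime^-∣ℤ-*-cancelˡ : Prime p → ¬ p ∣ℤ x → ∀ n → p ^ n ∣ℤ x ℤ.* y → p ^ n ∣ℤ y
prime^-∣ℤ-*-cancelˡ {x = x} {y = y} pp p∤x n p^n∣xy =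
  ∣ᵤ⇒∣ (prime^-∣-*-cancelˡ pp (p∤x ∘ ∣ᵤ⇒∣) n (subst (_ ∣_) (ℤᵖ.abs-* x y) (∣⇒∣ᵤ p^n∣xy)))

∤ℤ-small : 0 < n → n < p → ¬ p ∣ℤ + n
∤ℤ-small {n = suc n} _ n<p p∣n = ℕ.<⇒≱ n<p (∣⇒≤ (∣⇒∣ᵤ p∣n))

>3⇒∤ℤ-2 : 3 < p → ¬ p ∣ℤ + 2
>3⇒∤ℤ-2 3<p = ∤ℤ-small (s≤s z≤n) (ℕ.<-trans (ℕ.n<1+n 2) 3<p)

>3⇒∤ℤ-3 : 3 < p → ¬ p ∣ℤ + 3
>3⇒∤ℤ-3 = ∤ℤ-small (s≤s z≤n)

>3⇒∤ℤ-6 : Prime p → 3 < p → ¬ p ∣ℤ + 6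
>3⇒∤ℤ-6 pp 3<p = prime-∤ℤ-* pp (>3⇒∤ℤ-2 3<p) (>3⇒∤ℤ-3 3<p)

>3⇒∣ℤ-halve : Prime p → 3 < p → ∀ n → p ^ n ∣ℤ + 2 ℤ.* x → p ^ n ∣ℤ x
>3⇒∣ℤ-halve pp 3<p = prime^-∣ℤ-*-cancelˡ pp (>3⇒∤ℤ-2 3<p)

cubes-≡mod⇒≡mod : Prime p → 3 < p → ∀ n → ¬ p ∣ℤ x → x ≡ y mod p →
                  x ℤ.* x ℤ.* x ≡ y ℤ.* y ℤ.* y mod p ^ n → x ≡ y mod p ^ n
cubes-≡mod⇒≡mod {p = p} {x = x} {y = y} pp 3<p n p∤x (congruent p∣x-y) (congruent p^n∣x³-y³) =
  congruent (prime^-∣ℤ-*-cancelˡ pp p∤q n (∣ℤ-≡ p^n∣x³-y³ factor))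
  where
  factor : x ℤ.* x ℤ.* x ℤ.- y ℤ.* y ℤ.* y ≡ (x ℤ.* x ℤ.+ x ℤ.* y ℤ.+ y ℤ.* y) ℤ.* (x ℤ.- y)
  factor = solve (x ∷ y ∷ [])
  cofactor : (x ℤ.* x ℤ.+ x ℤ.* y ℤ.+ y ℤ.* y) ℤ.+ (x ℤ.- y) ℤ.* (y ℤ.+ + 2 ℤ.* x) ≡ + 3 ℤ.* (x ℤ.* x)
  cofactor = solve (x ∷ y ∷ [])
  p∤q : ¬ p ∣ℤ x ℤ.* x ℤ.+ x ℤ.* y ℤ.+ y ℤ.* y
  p∤q p∣q = prime-∤ℤ-* pp (>3⇒∤ℤ-3 3<p) (prime-∤ℤ-* pp p∤x p∤x)
    (∣ℤ-≡ (∣m∣n⇒∣m+n p∣q (∣m⇒∣m*n (y ℤ.+ + 2 ℤ.* x) p∣x-y)) cofactor)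

exact-power-∣ℤ-*-cancelˡ : Prime p → ∀ a n → p ^ a ∣ℤ x → ¬ p ^ suc a ∣ℤ x →
                          p ^ (a + n) ∣ℤ x ℤ.* y → p ^ n ∣ℤ y
exact-power-∣ℤ-*-cancelˡ {p = p} {y = y} pp a n (divides α refl) p^1+a∤x p^[a+n]∣xy =
  ℤᵈ.*-cancelˡ-∣ (+ P) (subst (ℤᵈ._∣ + P ℤ.* y) split (prime^-∣ℤ-*-cancelˡ pp p∤α (a + n) reassociated))
  where
  P = p ^ a
  instance _ = ℕ.m^n≢0 p a {{prime⇒nonZero pp}}
  p∤α : ¬ p ∣ℤ α
  p∤α (divides γ refl) = p^1+a∤x (divides γ (begin
    γ ℤ.* + p ℤ.* + P     ≡⟨ ℤᵖ.*-assoc γ (+ p) (+ P) ⟩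
    γ ℤ.* (+ p ℤ.* + P)   ≡⟨ cong (γ ℤ.*_) (ℤᵖ.pos-* p P) ⟨
    γ ℤ.* + (p * P)       ∎))
    where open ≡-Reasoning
  reassociated : p ^ (a + n) ∣ℤ α ℤ.* (+ P ℤ.* y)
  reassociated = ∣ℤ-≡ p^[a+n]∣xy (ℤᵖ.*-assoc α (+ P) y)
  split : + (p ^ (a + n)) ≡ + P ℤ.* + (p ^ n)
  split = trans (cong +_ (ℕ.^-distribˡ-+-* p a n)) (ℤᵖ.pos-* P (p ^ n))

∣ℤ-*⇒∣ℤ-factor : Prime p → ∀ a n → p ^ a ∣ℤ x → p ^ a ∣ℤ y → ¬ p ^ suc a ∣ℤ x ℤ.+ y →
                 p ^ (a + n) ∣ℤ x ℤ.* y → p ^ n ∣ℤ x ⊎ p ^ n ∣ℤ y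
∣ℤ-*⇒∣ℤ-factor {p = p} {x = x} {y = y} pp a n p^a∣x p^a∣y p^1+a∤x+y p^[a+n]∣xy
  with + (p ^ suc a) ∣? x
... | no p^1+a∤x = inj₂ (exact-power-∣ℤ-*-cancelˡ pp a n p^a∣x p^1+a∤x p^[a+n]∣xy)
... | yes p^1+a∣x = inj₁ (exact-power-∣ℤ-*-cancelˡ pp a n p^a∣y p^1+a∤y (∣ℤ-≡ p^[a+n]∣xy (ℤᵖ.*-comm x y)))
  where
  p^1+a∤y : ¬ p ^ suc a ∣ℤ y
  p^1+a∤y p^1+a∣y = p^1+a∤x+y (∣m∣n⇒∣m+n p^1+a∣x p^1+a∣y)

PairCong : ℕ → ℤ → ℤ → ℤ → ℤ → Set
PairCong m x y x′ y′ = (x ≡ x′ mod m × y ≡ y′ mod m) ⊎ (x ≡ y′ mod m × y ≡ x′ mod m)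

PairCong-unshift : PairCong m (x ℤ.- w) (y ℤ.- w) (x′ ℤ.- w) (y′ ℤ.- w) → PairCong m x y x′ y′
PairCong-unshift = Sum.map (Product.map ≡mod-unshift ≡mod-unshift) (Product.map ≡mod-unshift ≡mod-unshift)

-- Newton: 2Δp₃ − 3(x + y)Δp₂ = Q · Δp₁, where Q ≡ −6x′y′ (mod p) is a unit.
power-sums⇒sum-≡mod :
  Prime p → 3 < p → ∀ k x y → ¬ p ∣ℤ x′ → ¬ p ∣ℤ y′ →
  x ℤ.+ y ≡ x′ ℤ.+ y′ mod p →
  x ℤ.* x ℤ.+ y ℤ.* y ≡ x′ ℤ.* x′ ℤ.+ y′ ℤ.* y′ mod p ^ k →
  x ℤ.* x ℤ.* x ℤ.+ y ℤ.* y ℤ.* y ≡ x′ ℤ.* x′ ℤ.* x′ ℤ.+ y′ ℤ.* y′ ℤ.* y′ mod p ^ k →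
  x ℤ.+ y ≡ x′ ℤ.+ y′ mod p ^ k
power-sums⇒sum-≡mod {p = p} {x′ = x′} {y′ = y′} pp 3<p k x y p∤x′ p∤y′
  (congruent p∣σ) (congruent p^k∣σ₂) (congruent p^k∣σ₃) =
  congruent (prime^-∣ℤ-*-cancelˡ pp p∤Q k
    (∣ℤ-≡ (∣m∣n⇒∣m-n (∣n⇒∣m*n (+ 2) p^k∣σ₃) (∣n⇒∣m*n (+ 3 ℤ.* (x ℤ.+ y)) p^k∣σ₂)) Q-elimination))
  where
  Q-elimination : + 2 ℤ.* ((x ℤ.* x ℤ.* x ℤ.+ y ℤ.* y ℤ.* y) ℤ.- (x′ ℤ.* x′ ℤ.* x′ ℤ.+ y′ ℤ.* y′ ℤ.* y′))
                  ℤ.- + 3 ℤ.* (x ℤ.+ y) ℤ.* ((x ℤ.* x ℤ.+ y ℤ.* y) ℤ.- (x′ ℤ.* x′ ℤ.+ y′ ℤ.* y′))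
                ≡ (+ 3 ℤ.* (x′ ℤ.* x′ ℤ.+ y′ ℤ.* y′) ℤ.- ((x ℤ.+ y) ℤ.* (x ℤ.+ y) ℤ.+ (x ℤ.+ y) ℤ.* (x′ ℤ.+ y′)
                    ℤ.+ (x′ ℤ.+ y′) ℤ.* (x′ ℤ.+ y′))) ℤ.* ((x ℤ.+ y) ℤ.- (x′ ℤ.+ y′))
  Q-elimination = solve (x ∷ y ∷ x′ ∷ y′ ∷ [])
  Q-mod-σ : ℤ.- ((+ 3 ℤ.* (x′ ℤ.* x′ ℤ.+ y′ ℤ.* y′) ℤ.- ((x ℤ.+ y) ℤ.* (x ℤ.+ y) ℤ.+ (x ℤ.+ y) ℤ.* (x′ ℤ.+ y′)
                ℤ.+ (x′ ℤ.+ y′) ℤ.* (x′ ℤ.+ y′)))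
              ℤ.+ ((x ℤ.+ y) ℤ.- (x′ ℤ.+ y′)) ℤ.* ((x ℤ.+ y) ℤ.+ + 2 ℤ.* (x′ ℤ.+ y′)))
          ≡ + 6 ℤ.* (x′ ℤ.* y′)
  Q-mod-σ = solve (x ∷ y ∷ x′ ∷ y′ ∷ [])
  p∤Q : ¬ p ∣ℤ + 3 ℤ.* (x′ ℤ.* x′ ℤ.+ y′ ℤ.* y′) ℤ.- ((x ℤ.+ y) ℤ.* (x ℤ.+ y) ℤ.+ (x ℤ.+ y) ℤ.* (x′ ℤ.+ y′)
               ℤ.+ (x′ ℤ.+ y′) ℤ.* (x′ ℤ.+ y′))
  p∤Q p∣Q = prime-∤ℤ-* pp (>3⇒∤ℤ-6 pp 3<p) (prime-∤ℤ-* pp p∤x′ p∤y′)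
    (∣ℤ-≡ (∣m⇒∣-m (∣m∣n⇒∣m+n p∣Q (∣m⇒∣m*n ((x ℤ.+ y) ℤ.+ + 2 ℤ.* (x′ ℤ.+ y′)) p∣σ))) Q-mod-σ)

-- With e = (x − y) − (x′ − y′) and f = (x − y) + (x′ − y′) one has p^k ∣ e f, while e + f = 2(x − y)
-- is divisible by p^a exactly; so p^(k − a) divides e or f, which with x + y ≡ x′ + y′ fixes the pair.
sum-and-squares⇒PairCong :
  Prime p → 3 < p → ∀ a n → a + n ≤ k →
  x ≡ y mod p ^ a → ¬ x ≡ y mod p ^ suc a → x′ ≡ y′ mod p ^ a →
  x ℤ.+ y ≡ x′ ℤ.+ y′ mod p ^ k →
  x ℤ.* x ℤ.+ y ℤ.* y ≡ x′ ℤ.* x′ ℤ.+ y′ ℤ.* y′ mod p ^ k →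
  PairCong (p ^ n) x y x′ y′
sum-and-squares⇒PairCong {p = p} {k = k} {x = x} {y = y} {x′ = x′} {y′ = y′} pp 3<p a n a+n≤k
  (congruent p^a∣x-y) x≢y (congruent p^a∣x′-y′) (congruent p^k∣σ) (congruent p^k∣σ₂) =
  Sum.map from-e from-f (∣ℤ-*⇒∣ℤ-factor pp a n p^a∣e p^a∣f p^1+a∤e+f p^[a+n]∣ef)
  where
  ef-factorisation : + 2 ℤ.* ((x ℤ.* x ℤ.+ y ℤ.* y) ℤ.- (x′ ℤ.* x′ ℤ.+ y′ ℤ.* y′))
                     ℤ.- ((x ℤ.+ y) ℤ.- (x′ ℤ.+ y′)) ℤ.* ((x ℤ.+ y) ℤ.+ (x′ ℤ.+ y′))
                   ≡ ((x ℤ.- y) ℤ.- (x′ ℤ.- y′)) ℤ.* ((x ℤ.- y) ℤ.+ (x′ ℤ.- y′))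
  ef-factorisation = solve (x ∷ y ∷ x′ ∷ y′ ∷ [])
  p^[a+n]∣ef : p ^ (a + n) ∣ℤ ((x ℤ.- y) ℤ.- (x′ ℤ.- y′)) ℤ.* ((x ℤ.- y) ℤ.+ (x′ ℤ.- y′))
  p^[a+n]∣ef = ^-∣ℤ-weaken p a+n≤k
    (∣ℤ-≡ (∣m∣n⇒∣m-n (∣n⇒∣m*n (+ 2) p^k∣σ₂) (∣m⇒∣m*n ((x ℤ.+ y) ℤ.+ (x′ ℤ.+ y′)) p^k∣σ)) ef-factorisation)
  p^a∣e : p ^ a ∣ℤ (x ℤ.- y) ℤ.- (x′ ℤ.- y′)
  p^a∣e = ∣m∣n⇒∣m-n p^a∣x-y p^a∣x′-y′
  p^a∣f : p ^ a ∣ℤ (x ℤ.- y) ℤ.+ (x′ ℤ.- y′)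
  p^a∣f = ∣m∣n⇒∣m+n p^a∣x-y p^a∣x′-y′
  e+f : ((x ℤ.- y) ℤ.- (x′ ℤ.- y′)) ℤ.+ ((x ℤ.- y) ℤ.+ (x′ ℤ.- y′)) ≡ + 2 ℤ.* (x ℤ.- y)
  e+f = solve (x ∷ y ∷ x′ ∷ y′ ∷ [])
  p^1+a∤e+f : ¬ p ^ suc a ∣ℤ ((x ℤ.- y) ℤ.- (x′ ℤ.- y′)) ℤ.+ ((x ℤ.- y) ℤ.+ (x′ ℤ.- y′))
  p^1+a∤e+f p^1+a∣e+f = x≢y (congruent (>3⇒∣ℤ-halve pp 3<p (suc a) (∣ℤ-≡ p^1+a∣e+f e+f)))
  p^n∣σ : p ^ n ∣ℤ (x ℤ.+ y) ℤ.- (x′ ℤ.+ y′)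
  p^n∣σ = ^-∣ℤ-weaken p (ℕ.≤-trans (ℕ.m≤n+m n a) a+n≤k) p^k∣σ
  σ+e : ((x ℤ.+ y) ℤ.- (x′ ℤ.+ y′)) ℤ.+ ((x ℤ.- y) ℤ.- (x′ ℤ.- y′)) ≡ + 2 ℤ.* (x ℤ.- x′)
  σ+e = solve (x ∷ y ∷ x′ ∷ y′ ∷ [])
  σ-e : ((x ℤ.+ y) ℤ.- (x′ ℤ.+ y′)) ℤ.- ((x ℤ.- y) ℤ.- (x′ ℤ.- y′)) ≡ + 2 ℤ.* (y ℤ.- y′)
  σ-e = solve (x ∷ y ∷ x′ ∷ y′ ∷ [])
  σ+f : ((x ℤ.+ y) ℤ.- (x′ ℤ.+ y′)) ℤ.+ ((x ℤ.- y) ℤ.+ (x′ ℤ.- y′)) ≡ + 2 ℤ.* (x ℤ.- y′)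
  σ+f = solve (x ∷ y ∷ x′ ∷ y′ ∷ [])
  σ-f : ((x ℤ.+ y) ℤ.- (x′ ℤ.+ y′)) ℤ.- ((x ℤ.- y) ℤ.+ (x′ ℤ.- y′)) ≡ + 2 ℤ.* (y ℤ.- x′)
  σ-f = solve (x ∷ y ∷ x′ ∷ y′ ∷ [])
  from-e : p ^ n ∣ℤ (x ℤ.- y) ℤ.- (x′ ℤ.- y′) → x ≡ x′ mod p ^ n × y ≡ y′ mod p ^ n
  from-e p^n∣e = congruent (>3⇒∣ℤ-halve pp 3<p n (∣ℤ-≡ (∣m∣n⇒∣m+n p^n∣σ p^n∣e) σ+e))
               , congruent (>3⇒∣ℤ-halve pp 3<p n (∣ℤ-≡ (∣m∣n⇒∣m-n p^n∣σ p^n∣e) σ-e))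
  from-f : p ^ n ∣ℤ (x ℤ.- y) ℤ.+ (x′ ℤ.- y′) → x ≡ y′ mod p ^ n × y ≡ x′ mod p ^ n
  from-f p^n∣f = congruent (>3⇒∣ℤ-halve pp 3<p n (∣ℤ-≡ (∣m∣n⇒∣m+n p^n∣σ p^n∣f) σ+f))
               , congruent (>3⇒∣ℤ-halve pp 3<p n (∣ℤ-≡ (∣m∣n⇒∣m-n p^n∣σ p^n∣f) σ-f))

offsets-≡mod⇒≡mod : ∀ m q .{{_ : NonZero q}} {c o o′ : ℤ} →
                    x ℤ.- c ≡ o ℤ.* + m → y ℤ.- c ≡ o′ ℤ.* + m → o ℤ.%ℕ q ≡ o′ ℤ.%ℕ q →
                    x ≡ y mod m * q
offsets-≡mod⇒≡mod {x = x} {y = y} m q {c} {o} {o′} x-c≡om y-c≡o′m o≡o′ =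
  congruent (divides (o ℤ./ℕ q ℤ.- o′ ℤ./ℕ q) (begin
    x ℤ.- y                                                      ≡⟨ sub-sub-cancelʳ x y c ⟨
    (x ℤ.- c) ℤ.- (y ℤ.- c)                                      ≡⟨ cong₂ ℤ._-_ x-c≡om y-c≡o′m ⟩
    o ℤ.* + m ℤ.- o′ ℤ.* + m                                     ≡⟨ cong₂ (λ u v → u ℤ.* + m ℤ.- v ℤ.* + m)
                                                                      (ℤ.a≡a%ℕn+[a/ℕn]*n o q) o′≡ ⟩
    (+ r ℤ.+ t ℤ.* + q) ℤ.* + m ℤ.- (+ r ℤ.+ t′ ℤ.* + q) ℤ.* + m ≡⟨ regroup (+ r) t t′ (+ q) (+ m) ⟩
    (t ℤ.- t′) ℤ.* (+ m ℤ.* + q)                                 ≡⟨ cong ((t ℤ.- t′) ℤ.*_) (ℤᵖ.pos-* m q) ⟨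
    (t ℤ.- t′) ℤ.* + (m * q)                                     ∎))
  where
  open ≡-Reasoning
  r = o ℤ.%ℕ q
  t = o ℤ./ℕ q
  t′ = o′ ℤ./ℕ q
  o′≡ : o′ ≡ + r ℤ.+ t′ ℤ.* + q
  o′≡ = trans (ℤ.a≡a%ℕn+[a/ℕn]*n o′ q) (cong (λ s → + s ℤ.+ t′ ℤ.* + q) (sym o≡o′))
  regroup : ∀ r t t′ q m → (r ℤ.+ t ℤ.* q) ℤ.* m ℤ.- (r ℤ.+ t′ ℤ.* q) ℤ.* m ≡ (t ℤ.- t′) ℤ.* (m ℤ.* q)
  regroup = solve-∀

-- Key each element by its class and the residue modulo q of its offset from the class centre.
classes-bound : ∀ {t} m q .{{_ : NonZero q}} (z : Fin k → ℤ) (centre : Fin t → ℤ) →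
                (∀ i → ∃[ c ] z i ≡ centre c mod m) →
                (∀ i j → z i ≡ z j mod m → z i ≡ z j mod m * q → i ≡ j) →
                k ≤ t * q
classes-bound {k = k} {t = t} m q z centre classify separated = injective⇒≤ key-injective
  where
  colour : Fin k → Fin t
  colour i = proj₁ (classify i)
  offset : Fin k → ℤ
  offset i = ℤᵈ.quotient (_≡_mod_.difference (proj₂ (classify i)))
  offset-equation : ∀ i → z i ℤ.- centre (colour i) ≡ offset i ℤ.* + m
  offset-equation i = ℤᵈ._∣_.equality (_≡_mod_.difference (proj₂ (classify i)))
  digit : Fin k → Fin q
  digit i = fromℕ< (ℤ.n%ℕd<d (offset i) q)
  key : Fin k → Fin (t * q)
  key i = combine (colour i) (digit i)
  key-injective : ∀ {i j} → key i ≡ key j → i ≡ j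
  key-injective {i} {j} key≡ = separated i j
    (≡mod-trans (proj₂ (classify i)) (≡mod-sym zⱼ≡centreᵢ))
    (offsets-≡mod⇒≡mod m q {o = offset i} {o′ = offset j} (offset-equation i)
      (trans (cong (λ c → z j ℤ.- centre c) colour≡) (offset-equation j))
      (fromℕ<-injective _ _ _ _ digit≡))
    where
    colour≡×digit≡ : colour i ≡ colour j × digit i ≡ digit j
    colour≡×digit≡ = ,-injective (begin
      (colour i , digit i)  ≡⟨ remQuot-combine (colour i) (digit i) ⟨
      remQuot q (key i)     ≡⟨ cong (remQuot q) key≡ ⟩
      remQuot q (key j)     ≡⟨ remQuot-combine (colour j) (digit j) ⟩
      (colour j , digit j)  ∎)
      where open ≡-Reasoning
    colour≡ = proj₁ colour≡×digit≡
    digit≡ = proj₂ colour≡×digit≡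
    zⱼ≡centreᵢ : z j ≡ centre (colour i) mod m
    zⱼ≡centreᵢ = subst (λ c → z j ≡ centre c mod m) (sym colour≡) (proj₂ (classify j))

^2≡ : ∀ x → x ℤ.^ 2 ≡ x ℤ.* x
^2≡ x = cong (x ℤ.*_) (ℤᵖ.*-identityʳ x)

^3≡ : ∀ x → x ℤ.^ 3 ≡ x ℤ.* x ℤ.* x
^3≡ x = trans (cong (λ s → x ℤ.* (x ℤ.* s)) (ℤᵖ.*-identityʳ x)) (sym (ℤᵖ.*-assoc x x x))

powSum₁ : ∀ j (f : ℤ → ℤ) → (∀ u → u ℤ.^ j ≡ f u) → (z : Tuple 1) → powSum 1 z η j ≡ f (z zero ℤ.- η)
powSum₁ j f ^j≡f z = trans (ℤᵖ.+-identityʳ _) (^j≡f _)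

powSum₂ : ∀ j (f : ℤ → ℤ) → (∀ u → u ℤ.^ j ≡ f u) → (z : Tuple 2) →
          powSum 2 z η j ≡ f (z zero ℤ.- η) ℤ.+ f (z (suc zero) ℤ.- η)
powSum₂ j f ^j≡f z = cong₂ ℤ._+_ (^j≡f _) (trans (ℤᵖ.+-identityʳ _) (^j≡f _))

InB⇒∤ : Admissible p a b m₁ m₂ m₃ ξ η → InB p a b n m₁ m₂ m₃ ξ η z → ∀ i → ¬ p ∣ℤ z i ℤ.- η
InB⇒∤ {p = p} {a = zero} {η = η} {z = z} _ (_ , _ , _ , _ , _ , z≢η) i p∣z-η = z≢η refl i (≡mod⇒Cong z≡η)
  where
  z≡η : z i ≡ η mod p
  z≡η = congruent p∣z-η
InB⇒∤ {p = p} {a = suc a} {ξ = ξ} {η = η} {z = z}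
  (_ , _ , _ , _ , _ , _ , _ , _ , ξ-admissible) (_ , _ , _ , _ , (ζ , ζ∈Ξ , z≡ζ) , _) i p∣z-η =
  proj₂ (proj₂ (ξ-admissible λ ())) (≡mod⇒Cong η≡ξ)
  where
  z≡ζ′ : z i ≡ ζ i mod p ^ suc (suc a)
  z≡ζ′ = Cong⇒≡mod (z≡ζ i)
  ζ≡ξ : ζ i ≡ ξ mod p ^ suc a
  ζ≡ξ = Cong⇒≡mod (proj₂ (proj₂ (proj₁ ζ∈Ξ i)))
  z≡η : z i ≡ η mod p
  z≡η = congruent p∣z-η
  η≡ξ : η ≡ ξ mod p
  η≡ξ = ≡mod-trans (≡mod-sym z≡η)
          (≡mod-trans (^-≡mod⇒≡mod p (suc (suc a)) (s≤s z≤n) z≡ζ′) (^-≡mod⇒≡mod p (suc a) (s≤s z≤n) ζ≡ξ))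

a<b⇒1+a≤2b∸a : a < b → suc a ≤ 2 * b ∸ a
a<b⇒1+a≤2b∸a {a = a} {b = b} a<b =
  ℕ.m+n≤o⇒m≤o∸n (suc a) (ℕ.+-mono-≤ a<b (ℕ.≤-trans (ℕ.<⇒≤ a<b) (ℕ.m≤m+n b 0)))

a<b⇒1≤1*b : a < b → 1 ≤ 1 * b
a<b⇒1≤1*b {b = b} a<b = ℕ.≤-trans (ℕ.≤-trans (s≤s z≤n) a<b) (ℕ.m≤m+n b 0)

module Elements {p a b : ℕ} (pp : Prime p) (3<p : 3 < p) (a<b : a < b)
                (m₁ m₂ m₃ ξ η : ℤ) (adm : Admissible p a b m₁ m₂ m₃ ξ η) where

  In : ∀ n → Tuple n → Set
  In n = InB p a b n m₁ m₂ m₃ ξ η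

  In⇒powSum-≡mod : In n z → In n z′ →
                   powSum n z η 1 ≡ powSum n z′ η 1 mod p ^ (1 * b) ×
                   powSum n z η 2 ≡ powSum n z′ η 2 mod p ^ (2 * b) ×
                   powSum n z η 3 ≡ powSum n z′ η 3 mod p ^ (3 * b)
  In⇒powSum-≡mod (_ , c₁ , c₂ , c₃ , _) (_ , c₁′ , c₂′ , c₃′ , _) =
    Cong-common⇒≡mod m₁ c₁ c₁′ , Cong-common⇒≡mod m₂ c₂ c₂′ , Cong-common⇒≡mod m₃ c₃ c₃′

  In⇒∤ : In n z → ∀ i → ¬ p ∣ℤ z i ℤ.- η
  In⇒∤ = InB⇒∤ {p = p} {a = a} {b = b} {m₁ = m₁} {m₂ = m₂} {m₃ = m₃} {ξ = ξ} adm

  In₂⇒exact : In 2 z → z zero ≡ z (suc zero) mod p ^ a × ¬ z zero ≡ z (suc zero) mod p ^ suc a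
  In₂⇒exact {z = z} (_ , _ , _ , _ , (ζ , (ζ-range , ζ-distinct) , z≡ζ) , _) =
    ≡mod-trans (z≡ζ-mod-p^a zero)
      (≡mod-trans (ζ≡ξ zero) (≡mod-sym (≡mod-trans (z≡ζ-mod-p^a (suc zero)) (ζ≡ξ (suc zero))))) ,
    λ z₀≡z₁ → ζ-distinct zero (suc zero) (λ ())
      (≡mod⇒Cong (≡mod-trans (≡mod-sym (z≡ζ′ zero)) (≡mod-trans z₀≡z₁ (z≡ζ′ (suc zero)))))
    where
    z≡ζ′ : ∀ i → z i ≡ ζ i mod p ^ suc a
    z≡ζ′ i = Cong⇒≡mod (z≡ζ i)
    z≡ζ-mod-p^a : ∀ i → z i ≡ ζ i mod p ^ a
    z≡ζ-mod-p^a i = ^-≡mod-weaken p (ℕ.n≤1+n a) (z≡ζ′ i)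
    ζ≡ξ : ∀ i → ζ i ≡ ξ mod p ^ a
    ζ≡ξ i = Cong⇒≡mod (proj₂ (proj₂ (ζ-range i)))

  N : ℕ
  N = 2 * b ∸ a

  X Y : Tuple 2 → ℤ
  X z = z zero ℤ.- η
  Y z = z (suc zero) ℤ.- η

  power-sums : In 2 z → In 2 z′ →
               X z ℤ.+ Y z ≡ X z′ ℤ.+ Y z′ mod p ^ (1 * b) ×
               X z ℤ.* X z ℤ.+ Y z ℤ.* Y z ≡ X z′ ℤ.* X z′ ℤ.+ Y z′ ℤ.* Y z′ mod p ^ (2 * b) ×
               X z ℤ.* X z ℤ.* X z ℤ.+ Y z ℤ.* Y z ℤ.* Y z
                 ≡ X z′ ℤ.* X z′ ℤ.* X z′ ℤ.+ Y z′ ℤ.* Y z′ ℤ.* Y z′ mod p ^ (3 * b)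
  power-sums {z = z} {z′ = z′} z∈ z′∈ =
    ≡mod-resp σ₁ (powSum₂ 1 (λ u → u) ℤᵖ.^-identityʳ z) (powSum₂ 1 (λ u → u) ℤᵖ.^-identityʳ z′) ,
    ≡mod-resp σ₂ (powSum₂ 2 (λ u → u ℤ.* u) ^2≡ z) (powSum₂ 2 (λ u → u ℤ.* u) ^2≡ z′) ,
    ≡mod-resp σ₃ (powSum₂ 3 (λ u → u ℤ.* u ℤ.* u) ^3≡ z) (powSum₂ 3 (λ u → u ℤ.* u ℤ.* u) ^3≡ z′)
    where
    σ₁ = proj₁ (In⇒powSum-≡mod z∈ z′∈)
    σ₂ = proj₁ (proj₂ (In⇒powSum-≡mod z∈ z′∈))
    σ₃ = proj₂ (proj₂ (In⇒powSum-≡mod z∈ z′∈))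

  pair-congruent : In 2 z → In 2 z′ → PairCong (p ^ N) (z zero) (z (suc zero)) (z′ zero) (z′ (suc zero))
  pair-congruent {z = z} {z′ = z′} z∈ z′∈ = PairCong-unshift
    (sum-and-squares⇒PairCong pp 3<p a N (ℕ.≤-reflexive (ℕ.m+[n∸m]≡n a≤2b))
      (≡mod-shift (proj₁ (In₂⇒exact z∈))) (proj₂ (In₂⇒exact z∈) ∘ ≡mod-unshift)
      (≡mod-shift (proj₁ (In₂⇒exact z′∈))) sum σ₂)
    where
    a≤2b : a ≤ 2 * b
    a≤2b = ℕ.≤-trans (ℕ.<⇒≤ a<b) (ℕ.m≤m+n b (b + 0))
    σ₂ = proj₁ (proj₂ (power-sums z∈ z′∈))
    sum : X z ℤ.+ Y z ≡ X z′ ℤ.+ Y z′ mod p ^ (2 * b)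
    sum = power-sums⇒sum-≡mod pp 3<p (2 * b) (X z) (Y z) (In⇒∤ z′∈ zero) (In⇒∤ z′∈ (suc zero))
      (^-≡mod⇒≡mod p (1 * b) (a<b⇒1≤1*b a<b) (proj₁ (power-sums z∈ z′∈))) σ₂
      (^-≡mod-weaken p (ℕ.m≤n+m (2 * b) b) (proj₂ (proj₂ (power-sums z∈ z′∈))))

  first-coordinate : In 1 z → In 1 z′ → z zero ≡ z′ zero mod p ^ (3 * b)
  first-coordinate {z = z} {z′ = z′} z∈ z′∈ =
    ≡mod-unshift (cubes-≡mod⇒≡mod pp 3<p (3 * b) (In⇒∤ z∈ zero) linear cubic)
    where
    linear : z zero ℤ.- η ≡ z′ zero ℤ.- η mod p
    linear = ^-≡mod⇒≡mod p (1 * b) (a<b⇒1≤1*b a<b) (≡mod-resp (proj₁ (In⇒powSum-≡mod z∈ z′∈))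
      (powSum₁ 1 (λ u → u) ℤᵖ.^-identityʳ z) (powSum₁ 1 (λ u → u) ℤᵖ.^-identityʳ z′))
    cubic : (z zero ℤ.- η) ℤ.* (z zero ℤ.- η) ℤ.* (z zero ℤ.- η)
          ≡ (z′ zero ℤ.- η) ℤ.* (z′ zero ℤ.- η) ℤ.* (z′ zero ℤ.- η) mod p ^ (3 * b)
    cubic = ≡mod-resp (proj₂ (proj₂ (In⇒powSum-≡mod z∈ z′∈)))
      (powSum₁ 3 (λ u → u ℤ.* u ℤ.* u) ^3≡ z) (powSum₁ 3 (λ u → u ℤ.* u ℤ.* u) ^3≡ z′)

  second-coordinate : h ≤ 3 * b → In 2 z → In 2 z′ → z (suc zero) ≡ z′ (suc zero) mod p →
                      z zero ≡ z′ zero mod p ^ h → z (suc zero) ≡ z′ (suc zero) mod p ^ h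
  second-coordinate {h = h} h≤3b z∈ z′∈ y≡y′ x≡x′ =
    ≡mod-unshift (cubes-≡mod⇒≡mod pp 3<p h (In⇒∤ z∈ (suc zero)) (≡mod-shift y≡y′)
      (≡mod-+-cancelˡ (^-≡mod-weaken p h≤3b (proj₂ (proj₂ (power-sums z∈ z′∈))))
                      (≡mod-cube (≡mod-shift {w = η} x≡x′))))

  card≤1 : ClassCardLe p a b 1 (3 * b) m₁ m₂ m₃ ξ η 1
  card≤1 zero _ _ _ = z≤n
  card≤1 (suc zero) _ _ _ = s≤s z≤n
  card≤1 (suc (suc k)) f f∈ f-separated =
    ⊥-elim (f-separated zero (suc zero) (λ ()) λ { zero → ≡mod⇒Cong (first-coordinate (f∈ zero) (f∈ (suc zero))) })

  card≤2p^[h-N] : N ≤ h → h ≤ 3 * b → ClassCardLe p a b 2 h m₁ m₂ m₃ ξ η (2 * p ^ (h ∸ N))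
  card≤2p^[h-N] N≤h h≤3b zero f _ _ = z≤n
  card≤2p^[h-N] {h = h} N≤h h≤3b (suc k) f f∈ f-separated =
    classes-bound (p ^ N) (p ^ (h ∸ N)) (λ i → f i zero) (f zero) classify separated
    where
    instance _ = ℕ.m^n≢0 p (h ∸ N) {{prime⇒nonZero pp}}
    classify : ∀ i → ∃[ c ] f i zero ≡ f zero c mod p ^ N
    classify i = [ (zero ,_) ∘ proj₁ , (suc zero ,_) ∘ proj₁ ]′ (pair-congruent (f∈ i) (f∈ zero))
    separated : ∀ i j → f i zero ≡ f j zero mod p ^ N → f i zero ≡ f j zero mod p ^ N * p ^ (h ∸ N) → i ≡ j
    separated i j x≡N x≡′ = decidable-stable (i ≟ j) (λ i≢j → f-separated i j i≢j congruent-tuples)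
      where
      x≡h : f i zero ≡ f j zero mod p ^ h
      x≡h = subst (f i zero ≡ f j zero mod_) (^-+-∸ p N≤h) x≡′
      -- in the swapped case f j zero ≡ f j (suc zero) modulo p ^ N, hence modulo p ^ (a + 1)
      y≡N : f i (suc zero) ≡ f j (suc zero) mod p ^ N
      y≡N = [ proj₂ , (λ (xᵢ≡yⱼ , _) → ⊥-elim (proj₂ (In₂⇒exact (f∈ j))
                (^-≡mod-weaken p (a<b⇒1+a≤2b∸a a<b) (≡mod-trans (≡mod-sym x≡N) xᵢ≡yⱼ)))) ]′
            (pair-congruent (f∈ i) (f∈ j))
      congruent-tuples : TupCong (f i) (f j) (p ^ h)
      congruent-tuples zero = ≡mod⇒Cong x≡h
      congruent-tuples (suc zero) = ≡mod⇒Cong (second-coordinate h≤3b (f∈ i) (f∈ j)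
        (^-≡mod⇒≡mod p N (ℕ.≤-trans (s≤s z≤n) (a<b⇒1+a≤2b∸a a<b)) y≡N) x≡h)

BLe-mono : ∀ {μ N N′} → N ≤ N′ → BLe p a b n μ N → BLe p a b n μ N′
BLe-mono N≤N′ B m₁ m₂ m₃ ξ η adm k f f∈ f-separated =
  ℕ.≤-trans (B m₁ m₂ m₃ ξ η adm k f f∈ f-separated) N≤N′

h≤3b : ∀ a b h d e → 12 * d < e → h * e ≤ (2 * b ∸ a) * e + d * (b ∸ a) → h ≤ 3 * b
h≤3b a b h d e 12d<e he≤ = ℕ.*-cancelʳ-≤ h (3 * b) e (begin
  h * e                               ≤⟨ he≤ ⟩
  (2 * b ∸ a) * e + d * (b ∸ a)       ≤⟨ ℕ.+-monoʳ-≤ ((2 * b ∸ a) * e) (ℕ.*-mono-≤ d≤e (ℕ.m∸n≤m b a)) ⟩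
  (2 * b ∸ a) * e + e * b             ≤⟨ ℕ.+-monoˡ-≤ (e * b) (ℕ.*-monoˡ-≤ e (ℕ.m∸n≤m (2 * b) a)) ⟩
  2 * b * e + e * b                   ≡⟨ cong (λ t → 2 * b * e + t) (ℕ.*-comm e b) ⟩
  2 * b * e + b * e                   ≡⟨ ℕ.*-distribʳ-+ e (2 * b) b ⟨
  (2 * b + b) * e                     ≡⟨ cong (_* e) (ℕ.+-comm (2 * b) b) ⟩
  3 * b * e                           ∎)
  where
  open ℕ.≤-Reasoning
  instance _ = >-nonZero (ℕ.≤-trans (s≤s z≤n) 12d<e)
  d≤e : d ≤ e
  d≤e = ℕ.≤-trans (ℕ.m≤n*m d 12) (ℕ.<⇒≤ 12d<e)

lemma3p2 : (p : ℕ) → Prime p → 3 < p →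
           (d e : ℕ) → 0 < d → 12 * d < e →
           (a b h : ℕ) → a < b → 2 * b ∸ a ≤ h →
           h * e ≤ (2 * b ∸ a) * e + d * (b ∸ a) →
           BLe p a b 1 (3 * b) 6
           × BLe p a b 2 h (6 * p ^ (h ∸ (2 * b ∸ a)))
lemma3p2 p pp 3<p d e _ 12d<e a b h a<b N≤h he≤ =
  BLe-mono {p = p} {a = a} {b = b} {n = 1} {μ = 3 * b} (s≤s z≤n) (Elements.card≤1 pp 3<p a<b) ,
  BLe-mono {p = p} {a = a} {b = b} {n = 2} {μ = h} (ℕ.*-monoˡ-≤ (p ^ (h ∸ (2 * b ∸ a))) {2} {6} (s≤s (s≤s z≤n)))
    (λ m₁ m₂ m₃ ξ η adm → Elements.card≤2p^[h-N] pp 3<p a<b m₁ m₂ m₃ ξ η adm N≤h (h≤3b a b h d e 12d<e he≤))
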